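{- If $M\in{\cal T}'$ is correct and $M\triangleright M'$, then $M'$ is correct.
   Context: Intuitionistic variables $x,y,\dots$, classical variables $a,b,\dots$. Terms ${\cal T} ::= x \mid \lambda x\, {\cal T} \mid ({\cal T}\ {\cal E}) \mid \langle {\cal T},{\cal T}\rangle \mid \omega_1 {\cal T} \mid \omega_2 {\cal T} \mid \mu a\, {\cal T} \mid (a\ {\cal T})$, ${\cal E} ::= {\cal T} \mid \pi_1 \mid \pi_2 \mid [x.{\cal T}, y.{\cal T}]$. Reduction on ${\cal T}$: compatible closure of $(\lambda x M\ N)\triangleright M[x:=N]$; $(\langle M_1,M_2\rangle\ \pi_i)\triangleright M_i$; $(\omega_i M\ [x_1.N_1,x_2.N_2])\triangleright N_i[x_i:=M]$; $(M\ [x_1.N_1,x_2.N_2]\ \varepsilon)\triangleright (M\ [x_1.(N_1\ \varepsilon),x_2.(N_2\ \varepsilon)])$; $(\mu a M\ \varepsilon)\triangleright \mu a\, M[a:=^*\varepsilon]$, where $M[a:=^*\varepsilon]$ replaces each subterm $(a\ P)$ by $(a\ (P\ \varepsilon))$. Marked terms ${\cal T}'$: the grammar of ${\cal T}$ extended with $N^\star$ (for $N\in{\cal T}$) and $\boxed{\varepsilon}$ (in argument position, for $\varepsilon\in{\cal T}\cup\{\pi_1,\pi_2\}$), with $N,\varepsilon$ unmarked and closed (free variables treated as constants). Reduction on ${\cal T}'$: rules of ${\cal T}$, plus $N\triangleright N'$ implies $N^\star\triangleright N'^\star$ and $\boxed{N}\triangleright\boxed{N'}$, and $(N^\star\ \boxed{\varepsilon})\triangleright(N\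 \varepsilon)$. $M\in{\cal T}'$ is acceptable iff $M=N^\star$, or $M=\mu aM_1$ and for each subterm $(a\ N)$ of $M$, $N$ is acceptable, or $M=(N\ [x_1.N_1,x_2.N_2])$ with $N_1,N_2$ acceptable. For acceptable $M$: $st(N^\star)=\{N^\star\}$, $st(\mu aM_1)=\bigcup\{st(S)\mid(a\ S)$ subterm of $M_1\}$, $st((N\ [x_1.N_1,x_2.N_2]))=st(N_1)\cup st(N_2)$. $M\in{\cal T}'$ is correct if (1) each occurrence of a subterm $\boxed{\varepsilon}$ appears as $(U\ \boxed{\varepsilon})$ for some acceptable $U$, and (2) for each occurrence of a subterm $N^\star$ of $M$ there is a (necessarily unique) subterm of the form $(U\ \boxed{\varepsilon})$ such that $N^\star\in st(U)$. -}

module Defs where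

open import Data.Bool using (Bool; true; false; if_then_else_)
open import Data.Nat using (ℕ; zero; suc; _+_; _≡ᵇ_)
open import Data.List using (List; []; _∷_; _++_)
open import Data.Maybe using (Maybe; just; nothing)
open import Data.Product using (Σ; _×_; _,_; ∃-syntax)
open import Relation.Binary.PropositionalEquality using (_≡_)

-- Syntax.  De Bruijn indices; intuitionistic variables (bound by λ and
-- by the two branches of a case [x.N₁, y.N₂]) and classical variables
-- (bound by μ) live in two separate index spaces.
--
-- The Bool index says whether markings are allowed:
--   Tm false / El false  = the unmarked terms 𝒯 / eliminators ℰ,
--   Tm true  / El true   = the marked terms 𝒯' (and their eliminators).
-- A marked term N ⋆ carries an unmarked N; a boxed eliminator box ε
-- carries an unmarked ε ∈ 𝒯 ∪ {π₁, π₂}.  Their contents are atomic: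
-- substitutions / renamings never enter them.  Free variables inside
-- them are "constants": their indices are read relative to the top
-- level of the whole term being reduced (see the ⋆-box rule below).

mutual
  data Tm : Bool → Set where
    var  : ∀ {b} → ℕ → Tm b
    lam  : ∀ {b} → Tm b → Tm b
    app  : ∀ {b} → Tm b → El b → Tm b
    pair : ∀ {b} → Tm b → Tm b → Tm b
    ω₁   : ∀ {b} → Tm b → Tm b
    ω₂   : ∀ {b} → Tm b → Tm b
    μ    : ∀ {b} → Tm b → Tm b
    cvar : ∀ {b} → ℕ → Tm b → Tm b
    _⋆   : Tm false → Tm true

  data El : Bool → Set where
    term : ∀ {b} → Tm b → El b
    π₁   : ∀ {b} → El b
    π₂   : ∀ {b} → El b
    case : ∀ {b} → Tm b → Tm b → El b
    box  : Eps → El true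

  data Eps : Set where
    eT  : Tm false → Eps
    eπ₁ : Eps
    eπ₂ : Eps

epsEl : Eps → El false
epsEl (eT N) = term N
epsEl eπ₁    = π₁
epsEl eπ₂    = π₂

mutual
  mark : Tm false → Tm true
  mark (var x)    = var x
  mark (lam M)    = lam (mark M)
  mark (app M e)  = app (mark M) (markE e)
  mark (pair M N) = pair (mark M) (mark N)
  mark (ω₁ M)     = ω₁ (mark M)
  mark (ω₂ M)     = ω₂ (mark M)
  mark (μ M)      = μ (mark M)
  mark (cvar a M) = cvar a (mark M)

  markE : El false → El true
  markE (term M)   = term (mark M)
  markE π₁         = π₁
  markE π₂         = π₂
  markE (case M N) = case (mark M) (mark N)

ext : (ℕ → ℕ) → ℕ → ℕ
ext ρ zero    = zero
ext ρ (suc n) = suc (ρ n)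

mutual
  renᵢ : ∀ {b} → (ℕ → ℕ) → Tm b → Tm b
  renᵢ ρ (var x)    = var (ρ x)
  renᵢ ρ (lam M)    = lam (renᵢ (ext ρ) M)
  renᵢ ρ (app M e)  = app (renᵢ ρ M) (renᵢE ρ e)
  renᵢ ρ (pair M N) = pair (renᵢ ρ M) (renᵢ ρ N)
  renᵢ ρ (ω₁ M)     = ω₁ (renᵢ ρ M)
  renᵢ ρ (ω₂ M)     = ω₂ (renᵢ ρ M)
  renᵢ ρ (μ M)      = μ (renᵢ ρ M)
  renᵢ ρ (cvar a M) = cvar a (renᵢ ρ M)
  renᵢ ρ (N ⋆)      = N ⋆

  renᵢE : ∀ {b} → (ℕ → ℕ) → El b → El b
  renᵢE ρ (term M)   = term (renᵢ ρ M)
  renᵢE ρ π₁         = π₁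
  renᵢE ρ π₂         = π₂
  renᵢE ρ (case M N) = case (renᵢ (ext ρ) M) (renᵢ (ext ρ) N)
  renᵢE ρ (box ε)    = box ε

mutual
  renᶜ : ∀ {b} → (ℕ → ℕ) → Tm b → Tm b
  renᶜ ρ (var x)    = var x
  renᶜ ρ (lam M)    = lam (renᶜ ρ M)
  renᶜ ρ (app M e)  = app (renᶜ ρ M) (renᶜE ρ e)
  renᶜ ρ (pair M N) = pair (renᶜ ρ M) (renᶜ ρ N)
  renᶜ ρ (ω₁ M)     = ω₁ (renᶜ ρ M)
  renᶜ ρ (ω₂ M)     = ω₂ (renᶜ ρ M)
  renᶜ ρ (μ M)      = μ (renᶜ (ext ρ) M)
  renᶜ ρ (cvar a M) = cvar (ρ a) (renᶜ ρ M)
  renᶜ ρ (N ⋆)      = N ⋆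

  renᶜE : ∀ {b} → (ℕ → ℕ) → El b → El b
  renᶜE ρ (term M)   = term (renᶜ ρ M)
  renᶜE ρ π₁         = π₁
  renᶜE ρ π₂         = π₂
  renᶜE ρ (case M N) = case (renᶜ ρ M) (renᶜ ρ N)
  renᶜE ρ (box ε)    = box ε

mutual
  sub : ∀ {b} → (ℕ → Tm b) → Tm b → Tm b
  sub σ (var x)    = σ x
  sub σ (lam M)    = lam (sub (exts σ) M)
  sub σ (app M e)  = app (sub σ M) (subE σ e)
  sub σ (pair M N) = pair (sub σ M) (sub σ N)
  sub σ (ω₁ M)     = ω₁ (sub σ M)
  sub σ (ω₂ M)     = ω₂ (sub σ M)
  sub σ (μ M)      = μ (sub (λ n → renᶜ suc (σ n)) M)
  sub σ (cvar a M) = cvar a (sub σ M)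
  sub σ (N ⋆)      = N ⋆

  subE : ∀ {b} → (ℕ → Tm b) → El b → El b
  subE σ (term M)   = term (sub σ M)
  subE σ π₁         = π₁
  subE σ π₂         = π₂
  subE σ (case M N) = case (sub (exts σ) M) (sub (exts σ) N)
  subE σ (box ε)    = box ε

  exts : ∀ {b} → (ℕ → Tm b) → ℕ → Tm b
  exts σ zero    = var zero
  exts σ (suc n) = renᵢ suc (σ n)

single : ∀ {b} → Tm b → ℕ → Tm b
single N zero    = N
single N (suc n) = var n

_[0≔_] : ∀ {b} → Tm b → Tm b → Tm b
M [0≔ N ] = sub (single N) M

mutual
  sst : ∀ {b} → ℕ → El b → Tm b → Tm b
  sst k ε (var x)    = var x
  sst k ε (lam M)    = lam (sst k (renᵢE suc ε) M)
  sst k ε (app M e)  = app (sst k ε M) (sstE k ε e)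
  sst k ε (pair M N) = pair (sst k ε M) (sst k ε N)
  sst k ε (ω₁ M)     = ω₁ (sst k ε M)
  sst k ε (ω₂ M)     = ω₂ (sst k ε M)
  sst k ε (μ M)      = μ (sst (suc k) (renᶜE suc ε) M)
  sst k ε (cvar a M) =
    if a ≡ᵇ k then cvar a (app (sst k ε M) ε) else cvar a (sst k ε M)
  sst k ε (N ⋆)      = N ⋆

  sstE : ∀ {b} → ℕ → El b → El b → El b
  sstE k ε (term M)   = term (sst k ε M)
  sstE k ε π₁         = π₁
  sstE k ε π₂         = π₂
  sstE k ε (case M N) = case (sst k (renᵢE suc ε) M) (sst k (renᵢE suc ε) N)
  sstE k ε (box ε′)   = box ε′

-- shifting the "constant" free variables of a marked content when it is
-- released at binder depth (n intuitionistic, m classical)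
lift : ℕ → ℕ → Tm false → Tm false
lift n m N = renᶜ (m +_) (renᵢ (n +_) N)

liftEps : ℕ → ℕ → Eps → El false
liftEps n m (eT N) = term (lift n m N)
liftEps n m eπ₁    = π₁
liftEps n m eπ₂    = π₂

-- Red n m M M' : reduction of a subterm that sits under
-- n intuitionistic and m classical binders of the whole term; the depth
-- only matters for the ⋆-box rule.

mutual
  data Red : {b : Bool} → ℕ → ℕ → Tm b → Tm b → Set where
    β    : ∀ {b n m} {M N : Tm b} → Red n m (app (lam M) (term N)) (M [0≔ N ])
    π₁β  : ∀ {b n m} {M₁ M₂ : Tm b} → Red n m (app (pair M₁ M₂) π₁) M₁
    π₂β  : ∀ {b n m} {M₁ M₂ : Tm b} → Red n m (app (pair M₁ M₂) π₂) M₂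
    ω₁β  : ∀ {b n m} {M N₁ N₂ : Tm b} → Red n m (app (ω₁ M) (case N₁ N₂)) (N₁ [0≔ M ])
    ω₂β  : ∀ {b n m} {M N₁ N₂ : Tm b} → Red n m (app (ω₂ M) (case N₁ N₂)) (N₂ [0≔ M ])
    comm : ∀ {b n m} {M N₁ N₂ : Tm b} {ε : El b} →
           Red n m (app (app M (case N₁ N₂)) ε)
                   (app M (case (app N₁ (renᵢE suc ε)) (app N₂ (renᵢE suc ε))))
    μβ   : ∀ {b n m} {M : Tm b} {ε : El b} →
           Red n m (app (μ M) ε) (μ (sst 0 (renᶜE suc ε) M))
    lamᶜ  : ∀ {b n m} {M M′ : Tm b} → Red (suc n) m M M′ → Red n m (lam M) (lam M′)
    appˡ  : ∀ {b n m} {M M′ : Tm b} {e : El b} → Red n m M M′ → Red n m (app M e) (app M′ e)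
    appʳ  : ∀ {b n m} {M : Tm b} {e e′ : El b} → RedE n m e e′ → Red n m (app M e) (app M e′)
    pairˡ : ∀ {b n m} {M M′ N : Tm b} → Red n m M M′ → Red n m (pair M N) (pair M′ N)
    pairʳ : ∀ {b n m} {M N N′ : Tm b} → Red n m N N′ → Red n m (pair M N) (pair M N′)
    ω₁ᶜ   : ∀ {b n m} {M M′ : Tm b} → Red n m M M′ → Red n m (ω₁ M) (ω₁ M′)
    ω₂ᶜ   : ∀ {b n m} {M M′ : Tm b} → Red n m M M′ → Red n m (ω₂ M) (ω₂ M′)
    μᶜ    : ∀ {b n m} {M M′ : Tm b} → Red n (suc m) M M′ → Red n m (μ M) (μ M′)
    cvarᶜ : ∀ {b n m a} {M M′ : Tm b} → Red n m M M′ → Red n m (cvar a M) (cvar a M′)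
    ⋆ᶜ    : ∀ {n m} {N N′ : Tm false} → Red 0 0 N N′ → Red n m (N ⋆) (N′ ⋆)
    ⋆box  : ∀ {n m} {N : Tm false} {ε : Eps} →
            Red n m (app (N ⋆) (box ε)) (mark (app (lift n m N) (liftEps n m ε)))

  data RedE : {b : Bool} → ℕ → ℕ → El b → El b → Set where
    termᶜ : ∀ {b n m} {M M′ : Tm b} → Red n m M M′ → RedE n m (term M) (term M′)
    caseˡ : ∀ {b n m} {M M′ N : Tm b} → Red (suc n) m M M′ → RedE n m (case M N) (case M′ N)
    caseʳ : ∀ {b n m} {M N N′ : Tm b} → Red (suc n) m N N′ → RedE n m (case M N) (case M N′)
    boxᶜ  : ∀ {n m} {N N′ : Tm false} → Red 0 0 N N′ → RedE n m (box (eT N)) (box (eT N′))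

_▷_ : ∀ {b} → Tm b → Tm b → Set
M ▷ M′ = Red 0 0 M M′

data Dir : Set where
  lamD appFun appArg pairL pairR ω₁D ω₂D μD cvarD termD caseL caseR : Dir

Path : Set
Path = List Dir

data Node : Set where
  tmN : Tm true → Node
  elN : El true → Node

mutual
  at : Tm true → Path → Maybe Node
  at M            []            = just (tmN M)
  at (lam M)      (lamD ∷ p)    = at M p
  at (app M e)    (appFun ∷ p)  = at M p
  at (app M e)    (appArg ∷ p)  = atE e p
  at (pair M N)   (pairL ∷ p)   = at M p
  at (pair M N)   (pairR ∷ p)   = at N p
  at (ω₁ M)       (ω₁D ∷ p)     = at M p
  at (ω₂ M)       (ω₂D ∷ p)     = at M p
  at (μ M)        (μD ∷ p)      = at M p
  at (cvar a M)   (cvarD ∷ p)   = at M p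
  at _            (_ ∷ _)       = nothing

  atE : El true → Path → Maybe Node
  atE e            []           = just (elN e)
  atE (term M)     (termD ∷ p)  = at M p
  atE (case M N)   (caseL ∷ p)  = at M p
  atE (case M N)   (caseR ∷ p)  = at N p
  atE _            (_ ∷ _)      = nothing

-- number of classical binders (μ) crossed along a path; a subterm
-- (a S) at position p inside the body of μa has a = index (μcount p)
μcount : Path → ℕ
μcount []         = zero
μcount (μD ∷ p)   = suc (μcount p)
μcount (_ ∷ p)    = μcount p

data Acceptable : Tm true → Set where
  acc⋆    : ∀ {N} → Acceptable (N ⋆)
  accμ    : ∀ {M₁} →
            (∀ p S → at M₁ p ≡ just (tmN (cvar (μcount p) S)) → Acceptable S) →
            Acceptable (μ M₁)
  acccase : ∀ {N N₁ N₂} → Acceptable N₁ → Acceptable N₂ →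
            Acceptable (app N (case N₁ N₂))

-- InSt U r : the occurrence at position r of U is an element of st(U)
data InSt : Tm true → Path → Set where
  st⋆    : ∀ {N} → InSt (N ⋆) []
  stμ    : ∀ {M₁ S r₁ r₂} →
           at M₁ r₁ ≡ just (tmN (cvar (μcount r₁) S)) → InSt S r₂ →
           InSt (μ M₁) (μD ∷ (r₁ ++ (cvarD ∷ r₂)))
  stcaseˡ : ∀ {N N₁ N₂ r} → InSt N₁ r → InSt (app N (case N₁ N₂)) (appArg ∷ caseL ∷ r)
  stcaseʳ : ∀ {N N₁ N₂ r} → InSt N₂ r → InSt (app N (case N₁ N₂)) (appArg ∷ caseR ∷ r)

record Correct (M : Tm true) : Set where
  field
    boxes : ∀ q ε → at M q ≡ just (elN (box ε)) →
            ∃[ q′ ] ∃[ U ] (q ≡ q′ ++ (appArg ∷ [])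
                            × at M q′ ≡ just (tmN (app U (box ε)))
                            × Acceptable U)
    stars : ∀ p N → at M p ≡ just (tmN (N ⋆)) →
            ∃[ q ] ∃[ U ] ∃[ ε ] ∃[ r ] (at M q ≡ just (tmN (app U (box ε)))
                                        × Acceptable U
                                        × InSt U r
                                        × p ≡ q ++ (appFun ∷ r))

-- Correct M holds exactly when ∅ ⊢[ false ] M for a syntax-directed judgement
-- Γ ⊢[ b ] M, since positions, owners and st(·) all decompose along the syntax.
-- The mode b says whether M stands in acceptable position (applied to a box, or
-- argument of a classical variable bound by an acceptable μ), Γ says which
-- classical variables are bound by an acceptable μ, and N⋆ may only stand in
-- acceptable position.  Being syntax directed, the judgement is stable under
-- renaming, substitution and structural substitution, so every reduction rule
-- preserves it.  The ⋆-box rule releases an unmarked term whose free classical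
-- variables are constants, hence never bound by an acceptable μ.

module Submission where

open import Defs
open import Data.Bool using (Bool; true; false)
open import Data.Empty using (⊥; ⊥-elim)
open import Data.List using ([]; _∷_; _++_)
open import Data.List.Properties using (++-assoc; ∷-injective; ∷-injectiveʳ)
open import Data.Maybe using (Maybe; just)
open import Data.Nat using (ℕ; zero; suc; _+_; _≡ᵇ_)
open import Data.Nat.Properties using (≡ᵇ⇒≡; ≡⇒≡ᵇ; +-identityʳ; +-suc)
open import Data.Product using (_×_; _,_; Σ-syntax)
open import Data.Sum using (_⊎_; inj₁; inj₂)
open import Data.Unit using (⊤; tt)
open import Function using (_∘_; case_of_)
open import Relation.Nullary using (¬_)
open import Relation.Binary.PropositionalEquality using (_≡_; _≢_; refl; sym; trans; cong; subst)

Ctx : Set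
Ctx = ℕ → Bool

infixl 5 _▸_
_▸_ : Ctx → Bool → Ctx
(Γ ▸ c) zero    = c
(Γ ▸ c) (suc k) = Γ k

private variable
  Γ Δ : Ctx
  b b′ c : Bool
  M M′ N N₁ N₂ S T U : Tm true
  e e′ : El true
  K : Tm false
  ε : Eps
  ρ : ℕ → ℕ
  σ : ℕ → Tm true
  d : Dir
  p q r : Path
  v : Node
  a k n m x : ℕ

infix 4 _⊢[_]_ _⊢_∶_⇒_ _∶_⇛_ _⊢ˢ_

-- Γ ⊢ e ∶ b ⇒ b′ : applying e to a term of mode b yields a term of mode b′.
mutual
  data _⊢[_]_ : Ctx → Bool → Tm true → Set where
    ⊢var  : Γ ⊢[ false ] var x
    ⊢lam  : Γ ⊢[ false ] M → Γ ⊢[ false ] lam M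
    ⊢app  : Γ ⊢[ b ] M → Γ ⊢ e ∶ b ⇒ b′ → Γ ⊢[ b′ ] app M e
    ⊢pair : Γ ⊢[ false ] M → Γ ⊢[ false ] N → Γ ⊢[ false ] pair M N
    ⊢ω₁   : Γ ⊢[ false ] M → Γ ⊢[ false ] ω₁ M
    ⊢ω₂   : Γ ⊢[ false ] M → Γ ⊢[ false ] ω₂ M
    ⊢μ    : Γ ▸ b ⊢[ false ] M → Γ ⊢[ b ] μ M
    ⊢cvar : Γ ⊢[ Γ a ] M → Γ ⊢[ false ] cvar a M
    ⊢⋆    : Γ ⊢[ true ] K ⋆

  data _⊢_∶_⇒_ : Ctx → El true → Bool → Bool → Set where
    term⇒ : Γ ⊢[ false ] M → Γ ⊢ term M ∶ false ⇒ false
    π₁⇒   : Γ ⊢ π₁ ∶ false ⇒ false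
    π₂⇒   : Γ ⊢ π₂ ∶ false ⇒ false
    case⇒ : Γ ⊢[ b ] M → Γ ⊢[ b ] N → Γ ⊢ case M N ∶ false ⇒ b
    box⇒  : Γ ⊢ box ε ∶ true ⇒ false

mutual
  ⊢-renᵢ : ∀ ρ → Γ ⊢[ b ] M → Γ ⊢[ b ] renᵢ ρ M
  ⊢-renᵢ ρ ⊢var         = ⊢var
  ⊢-renᵢ ρ (⊢lam h)     = ⊢lam (⊢-renᵢ (ext ρ) h)
  ⊢-renᵢ ρ (⊢app h hₑ)  = ⊢app (⊢-renᵢ ρ h) (⇒-renᵢ ρ hₑ)
  ⊢-renᵢ ρ (⊢pair h h′) = ⊢pair (⊢-renᵢ ρ h) (⊢-renᵢ ρ h′)
  ⊢-renᵢ ρ (⊢ω₁ h)      = ⊢ω₁ (⊢-renᵢ ρ h)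
  ⊢-renᵢ ρ (⊢ω₂ h)      = ⊢ω₂ (⊢-renᵢ ρ h)
  ⊢-renᵢ ρ (⊢μ h)       = ⊢μ (⊢-renᵢ ρ h)
  ⊢-renᵢ ρ (⊢cvar h)    = ⊢cvar (⊢-renᵢ ρ h)
  ⊢-renᵢ ρ ⊢⋆           = ⊢⋆

  ⇒-renᵢ : ∀ ρ → Γ ⊢ e ∶ b ⇒ b′ → Γ ⊢ renᵢE ρ e ∶ b ⇒ b′
  ⇒-renᵢ ρ (term⇒ h)     = term⇒ (⊢-renᵢ ρ h)
  ⇒-renᵢ ρ π₁⇒           = π₁⇒
  ⇒-renᵢ ρ π₂⇒           = π₂⇒
  ⇒-renᵢ ρ (case⇒ h h′)  = case⇒ (⊢-renᵢ (ext ρ) h) (⊢-renᵢ (ext ρ) h′)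
  ⇒-renᵢ ρ box⇒          = box⇒

_∶_⇛_ : (ℕ → ℕ) → Ctx → Ctx → Set
ρ ∶ Γ ⇛ Δ = ∀ k → Δ (ρ k) ≡ Γ k

ext-⇛ : ∀ c → ρ ∶ Γ ⇛ Δ → ext ρ ∶ Γ ▸ c ⇛ Δ ▸ c
ext-⇛ c ρ⇛ zero    = refl
ext-⇛ c ρ⇛ (suc k) = ρ⇛ k

mutual
  ⊢-renᶜ : ρ ∶ Γ ⇛ Δ → Γ ⊢[ b ] M → Δ ⊢[ b ] renᶜ ρ M
  ⊢-renᶜ ρ⇛ ⊢var          = ⊢var
  ⊢-renᶜ ρ⇛ (⊢lam h)      = ⊢lam (⊢-renᶜ ρ⇛ h)
  ⊢-renᶜ ρ⇛ (⊢app h hₑ)   = ⊢app (⊢-renᶜ ρ⇛ h) (⇒-renᶜ ρ⇛ hₑ)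
  ⊢-renᶜ ρ⇛ (⊢pair h h′)  = ⊢pair (⊢-renᶜ ρ⇛ h) (⊢-renᶜ ρ⇛ h′)
  ⊢-renᶜ ρ⇛ (⊢ω₁ h)       = ⊢ω₁ (⊢-renᶜ ρ⇛ h)
  ⊢-renᶜ ρ⇛ (⊢ω₂ h)       = ⊢ω₂ (⊢-renᶜ ρ⇛ h)
  ⊢-renᶜ ρ⇛ (⊢μ {b = b} h) = ⊢μ (⊢-renᶜ (ext-⇛ b ρ⇛) h)
  ⊢-renᶜ {Δ = Δ} ρ⇛ (⊢cvar {a = a} h) =
    ⊢cvar (subst (Δ ⊢[_] _) (sym (ρ⇛ a)) (⊢-renᶜ ρ⇛ h))
  ⊢-renᶜ ρ⇛ ⊢⋆            = ⊢⋆

  ⇒-renᶜ : ρ ∶ Γ ⇛ Δ → Γ ⊢ e ∶ b ⇒ b′ → Δ ⊢ renᶜE ρ e ∶ b ⇒ b′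
  ⇒-renᶜ ρ⇛ (term⇒ h)    = term⇒ (⊢-renᶜ ρ⇛ h)
  ⇒-renᶜ ρ⇛ π₁⇒          = π₁⇒
  ⇒-renᶜ ρ⇛ π₂⇒          = π₂⇒
  ⇒-renᶜ ρ⇛ (case⇒ h h′) = case⇒ (⊢-renᶜ ρ⇛ h) (⊢-renᶜ ρ⇛ h′)
  ⇒-renᶜ ρ⇛ box⇒         = box⇒

⊢-weakenᶜ : Γ ⊢[ b ] M → Γ ▸ c ⊢[ b ] renᶜ suc M
⊢-weakenᶜ = ⊢-renᶜ λ _ → refl

⇒-weakenᶜ : Γ ⊢ e ∶ b ⇒ b′ → Γ ▸ c ⊢ renᶜE suc e ∶ b ⇒ b′
⇒-weakenᶜ = ⇒-renᶜ λ _ → refl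

_⊢ˢ_ : Ctx → (ℕ → Tm true) → Set
Γ ⊢ˢ σ = ∀ x → Γ ⊢[ false ] σ x

exts-⊢ˢ : Γ ⊢ˢ σ → Γ ⊢ˢ exts σ
exts-⊢ˢ hσ zero    = ⊢var
exts-⊢ˢ hσ (suc x) = ⊢-renᵢ suc (hσ x)

mutual
  ⊢-sub : Γ ⊢ˢ σ → Γ ⊢[ b ] M → Γ ⊢[ b ] sub σ M
  ⊢-sub hσ ⊢var         = hσ _
  ⊢-sub hσ (⊢lam h)     = ⊢lam (⊢-sub (exts-⊢ˢ hσ) h)
  ⊢-sub hσ (⊢app h hₑ)  = ⊢app (⊢-sub hσ h) (⇒-sub hσ hₑ)
  ⊢-sub hσ (⊢pair h h′) = ⊢pair (⊢-sub hσ h) (⊢-sub hσ h′)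
  ⊢-sub hσ (⊢ω₁ h)      = ⊢ω₁ (⊢-sub hσ h)
  ⊢-sub hσ (⊢ω₂ h)      = ⊢ω₂ (⊢-sub hσ h)
  ⊢-sub hσ (⊢μ h)       = ⊢μ (⊢-sub (λ x → ⊢-weakenᶜ (hσ x)) h)
  ⊢-sub hσ (⊢cvar h)    = ⊢cvar (⊢-sub hσ h)
  ⊢-sub hσ ⊢⋆           = ⊢⋆

  ⇒-sub : Γ ⊢ˢ σ → Γ ⊢ e ∶ b ⇒ b′ → Γ ⊢ subE σ e ∶ b ⇒ b′
  ⇒-sub hσ (term⇒ h)    = term⇒ (⊢-sub hσ h)
  ⇒-sub hσ π₁⇒          = π₁⇒
  ⇒-sub hσ π₂⇒          = π₂⇒
  ⇒-sub hσ (case⇒ h h′) = case⇒ (⊢-sub (exts-⊢ˢ hσ) h) (⊢-sub (exts-⊢ˢ hσ) h′)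
  ⇒-sub hσ box⇒         = box⇒

⊢-[0≔] : Γ ⊢[ b ] M → Γ ⊢[ false ] N → Γ ⊢[ b ] M [0≔ N ]
⊢-[0≔] {N = N} hM hN = ⊢-sub single-⊢ˢ hM
  where
    single-⊢ˢ : _ ⊢ˢ single N
    single-⊢ˢ zero    = hN
    single-⊢ˢ (suc x) = ⊢var

AgreeExcept : ℕ → Ctx → Ctx → Set
AgreeExcept k Γ Δ = ∀ j → j ≢ k → Δ j ≡ Γ j

AgreeExcept-▸ : ∀ c → AgreeExcept k Γ Δ → AgreeExcept (suc k) (Γ ▸ c) (Δ ▸ c)
AgreeExcept-▸ c agree zero    _   = refl
AgreeExcept-▸ c agree (suc j) j≢k = agree j λ j≡k → j≢k (cong suc j≡k)

AgreeExcept-zero : AgreeExcept 0 (Γ ▸ b) (Γ ▸ b′)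
AgreeExcept-zero zero    0≢0 = ⊥-elim (0≢0 refl)
AgreeExcept-zero (suc j) _   = refl

-- An argument (k S) of mode Γ k becomes (k (S e)), which e turns into mode Δ k.
mutual
  ⊢-sst : AgreeExcept k Γ Δ → Δ ⊢ e ∶ Γ k ⇒ Δ k → Γ ⊢[ b ] M → Δ ⊢[ b ] sst k e M
  ⊢-sst agree hₑ ⊢var          = ⊢var
  ⊢-sst agree hₑ (⊢lam h)      = ⊢lam (⊢-sst agree (⇒-renᵢ suc hₑ) h)
  ⊢-sst agree hₑ (⊢app h hₑ′)  = ⊢app (⊢-sst agree hₑ h) (⇒-sst agree hₑ hₑ′)
  ⊢-sst agree hₑ (⊢pair h h′)  = ⊢pair (⊢-sst agree hₑ h) (⊢-sst agree hₑ h′)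
  ⊢-sst agree hₑ (⊢ω₁ h)       = ⊢ω₁ (⊢-sst agree hₑ h)
  ⊢-sst agree hₑ (⊢ω₂ h)       = ⊢ω₂ (⊢-sst agree hₑ h)
  ⊢-sst agree hₑ (⊢μ {b = c} h) = ⊢μ (⊢-sst (AgreeExcept-▸ c agree) (⇒-weakenᶜ hₑ) h)
  ⊢-sst {k = k} agree hₑ (⊢cvar {a = a} h) with a ≡ᵇ k | ≡ᵇ⇒≡ a k | ≡⇒≡ᵇ a k
  ... | true  | a≡k | _ with a≡k _
  ...   | refl = ⊢cvar (⊢app (⊢-sst agree hₑ h) hₑ)
  ⊢-sst agree hₑ (⊢cvar {a = a} h) | false | _ | a≢k =
    ⊢cvar (subst (_ ⊢[_] _) (sym (agree a a≢k)) (⊢-sst agree hₑ h))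
  ⊢-sst agree hₑ ⊢⋆            = ⊢⋆

  ⇒-sst : AgreeExcept k Γ Δ → Δ ⊢ e ∶ Γ k ⇒ Δ k →
          Γ ⊢ e′ ∶ b ⇒ b′ → Δ ⊢ sstE k e e′ ∶ b ⇒ b′
  ⇒-sst agree hₑ (term⇒ h)    = term⇒ (⊢-sst agree hₑ h)
  ⇒-sst agree hₑ π₁⇒          = π₁⇒
  ⇒-sst agree hₑ π₂⇒          = π₂⇒
  ⇒-sst agree hₑ (case⇒ h h′) =
    case⇒ (⊢-sst agree (⇒-renᵢ suc hₑ) h) (⊢-sst agree (⇒-renᵢ suc hₑ) h′)
  ⇒-sst agree hₑ box⇒         = box⇒

ext-false : (∀ k → Γ (ρ k) ≡ false) → ∀ k → (Γ ▸ false) (ext ρ k) ≡ false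
ext-false ρ⊥ zero    = refl
ext-false ρ⊥ (suc k) = ρ⊥ k

mutual
  ⊢-mark : (∀ k → Γ (ρ k) ≡ false) → ∀ K → Γ ⊢[ false ] mark (renᶜ ρ K)
  ⊢-mark ρ⊥ (var x)    = ⊢var
  ⊢-mark ρ⊥ (lam K)    = ⊢lam (⊢-mark ρ⊥ K)
  ⊢-mark ρ⊥ (app K e)  = ⊢app (⊢-mark ρ⊥ K) (⇒-mark ρ⊥ e)
  ⊢-mark ρ⊥ (pair K L) = ⊢pair (⊢-mark ρ⊥ K) (⊢-mark ρ⊥ L)
  ⊢-mark ρ⊥ (ω₁ K)     = ⊢ω₁ (⊢-mark ρ⊥ K)
  ⊢-mark ρ⊥ (ω₂ K)     = ⊢ω₂ (⊢-mark ρ⊥ K)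
  ⊢-mark ρ⊥ (μ K)      = ⊢μ (⊢-mark (ext-false ρ⊥) K)
  ⊢-mark {Γ = Γ} ρ⊥ (cvar a K) = ⊢cvar (subst (Γ ⊢[_] _) (sym (ρ⊥ a)) (⊢-mark ρ⊥ K))

  ⇒-mark : (∀ k → Γ (ρ k) ≡ false) → ∀ e → Γ ⊢ markE (renᶜE ρ e) ∶ false ⇒ false
  ⇒-mark ρ⊥ (term K)   = term⇒ (⊢-mark ρ⊥ K)
  ⇒-mark ρ⊥ π₁         = π₁⇒
  ⇒-mark ρ⊥ π₂         = π₂⇒
  ⇒-mark ρ⊥ (case K L) = case⇒ (⊢-mark ρ⊥ K) (⊢-mark ρ⊥ L)

-- At binder depth m the free classical variables of the whole term are
-- m, m + 1, …; they are never bound by an acceptable μ.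
mutual
  ⊢-red : (∀ k → Γ (m + k) ≡ false) → Red n m M M′ → Γ ⊢[ b ] M → Γ ⊢[ b ] M′
  ⊢-red Γm β    (⊢app (⊢lam h) (term⇒ h′))        = ⊢-[0≔] h h′
  ⊢-red Γm π₁β  (⊢app (⊢pair h _) π₁⇒)            = h
  ⊢-red Γm π₂β  (⊢app (⊢pair _ h) π₂⇒)            = h
  ⊢-red Γm ω₁β  (⊢app (⊢ω₁ h) (case⇒ h₁ _))       = ⊢-[0≔] h₁ h
  ⊢-red Γm ω₂β  (⊢app (⊢ω₂ h) (case⇒ _ h₂))       = ⊢-[0≔] h₂ h
  ⊢-red Γm comm (⊢app (⊢app h (case⇒ h₁ h₂)) hₑ) =
    ⊢app h (case⇒ (⊢app h₁ (⇒-renᵢ suc hₑ)) (⊢app h₂ (⇒-renᵢ suc hₑ)))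
  ⊢-red Γm μβ   (⊢app (⊢μ h) hₑ)                  = ⊢μ (⊢-sst AgreeExcept-zero (⇒-weakenᶜ hₑ) h)
  ⊢-red Γm (lamᶜ r)  (⊢lam h)      = ⊢lam (⊢-red Γm r h)
  ⊢-red Γm (appˡ r)  (⊢app h hₑ)   = ⊢app (⊢-red Γm r h) hₑ
  ⊢-red Γm (appʳ r)  (⊢app h hₑ)   = ⊢app h (⇒-red Γm r hₑ)
  ⊢-red Γm (pairˡ r) (⊢pair h h′)  = ⊢pair (⊢-red Γm r h) h′
  ⊢-red Γm (pairʳ r) (⊢pair h h′)  = ⊢pair h (⊢-red Γm r h′)
  ⊢-red Γm (ω₁ᶜ r)   (⊢ω₁ h)       = ⊢ω₁ (⊢-red Γm r h)
  ⊢-red Γm (ω₂ᶜ r)   (⊢ω₂ h)       = ⊢ω₂ (⊢-red Γm r h)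
  ⊢-red Γm (μᶜ r)    (⊢μ h)        = ⊢μ (⊢-red Γm r h)
  ⊢-red Γm (cvarᶜ r) (⊢cvar h)     = ⊢cvar (⊢-red Γm r h)
  ⊢-red Γm (⋆ᶜ r)    ⊢⋆            = ⊢⋆
  ⊢-red Γm (⋆box {n} {N = K} {ε}) (⊢app ⊢⋆ box⇒) =
    ⊢app (⊢-mark Γm (renᵢ (n +_) K)) (liftEps⇒ ε)
    where
      liftEps⇒ : ∀ ε → _ ⊢ markE (liftEps n _ ε) ∶ false ⇒ false
      liftEps⇒ (eT L) = term⇒ (⊢-mark Γm (renᵢ (n +_) L))
      liftEps⇒ eπ₁    = π₁⇒
      liftEps⇒ eπ₂    = π₂⇒

  ⇒-red : (∀ k → Γ (m + k) ≡ false) → RedE n m e e′ → Γ ⊢ e ∶ b ⇒ b′ → Γ ⊢ e′ ∶ b ⇒ b′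
  ⇒-red Γm (termᶜ r) (term⇒ h)    = term⇒ (⊢-red Γm r h)
  ⇒-red Γm (caseˡ r) (case⇒ h h′) = case⇒ (⊢-red Γm r h) h′
  ⇒-red Γm (caseʳ r) (case⇒ h h′) = case⇒ h (⊢-red Γm r h′)
  ⇒-red Γm (boxᶜ r)  box⇒         = box⇒

data At : Tm true → Path → Node → Set where
  at-here  : At T [] (tmN T)
  at-lam   : At M p v → At (lam M) (lamD ∷ p) v
  at-fun   : At M p v → At (app M e) (appFun ∷ p) v
  at-arg   : At (app M e) (appArg ∷ []) (elN e)
  at-term  : At N p v → At (app M (term N)) (appArg ∷ termD ∷ p) v
  at-caseL : At N₁ p v → At (app M (case N₁ N₂)) (appArg ∷ caseL ∷ p) v
  at-caseR : At N₂ p v → At (app M (case N₁ N₂)) (appArg ∷ caseR ∷ p) v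
  at-pairL : At M p v → At (pair M N) (pairL ∷ p) v
  at-pairR : At N p v → At (pair M N) (pairR ∷ p) v
  at-ω₁    : At M p v → At (ω₁ M) (ω₁D ∷ p) v
  at-ω₂    : At M p v → At (ω₂ M) (ω₂D ∷ p) v
  at-μ     : At M p v → At (μ M) (μD ∷ p) v
  at-cvar  : At M p v → At (cvar a M) (cvarD ∷ p) v

-- `at` ends with a catch-all clause, so inverting it takes one clause per
-- constructor and direction.
mutual
  at-view : ∀ T p → at T p ≡ just v → At T p v
  at-view T [] refl = at-here
  at-view (var x) (d ∷ p) ()
  at-view (lam M) (lamD ∷ p) eq = at-lam (at-view M p eq)
  at-view (lam M) (appFun ∷ p) ()
  at-view (lam M) (appArg ∷ p) ()
  at-view (lam M) (pairL ∷ p) ()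
  at-view (lam M) (pairR ∷ p) ()
  at-view (lam M) (ω₁D ∷ p) ()
  at-view (lam M) (ω₂D ∷ p) ()
  at-view (lam M) (μD ∷ p) ()
  at-view (lam M) (cvarD ∷ p) ()
  at-view (lam M) (termD ∷ p) ()
  at-view (lam M) (caseL ∷ p) ()
  at-view (lam M) (caseR ∷ p) ()
  at-view (app M e) (lamD ∷ p) ()
  at-view (app M e) (appFun ∷ p) eq = at-fun (at-view M p eq)
  at-view (app M e) (appArg ∷ p) eq = arg-view e p eq
  at-view (app M e) (pairL ∷ p) ()
  at-view (app M e) (pairR ∷ p) ()
  at-view (app M e) (ω₁D ∷ p) ()
  at-view (app M e) (ω₂D ∷ p) ()
  at-view (app M e) (μD ∷ p) ()
  at-view (app M e) (cvarD ∷ p) ()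
  at-view (app M e) (termD ∷ p) ()
  at-view (app M e) (caseL ∷ p) ()
  at-view (app M e) (caseR ∷ p) ()
  at-view (pair M N) (lamD ∷ p) ()
  at-view (pair M N) (appFun ∷ p) ()
  at-view (pair M N) (appArg ∷ p) ()
  at-view (pair M N) (pairL ∷ p) eq = at-pairL (at-view M p eq)
  at-view (pair M N) (pairR ∷ p) eq = at-pairR (at-view N p eq)
  at-view (pair M N) (ω₁D ∷ p) ()
  at-view (pair M N) (ω₂D ∷ p) ()
  at-view (pair M N) (μD ∷ p) ()
  at-view (pair M N) (cvarD ∷ p) ()
  at-view (pair M N) (termD ∷ p) ()
  at-view (pair M N) (caseL ∷ p) ()
  at-view (pair M N) (caseR ∷ p) ()
  at-view (ω₁ M) (lamD ∷ p) ()
  at-view (ω₁ M) (appFun ∷ p) ()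
  at-view (ω₁ M) (appArg ∷ p) ()
  at-view (ω₁ M) (pairL ∷ p) ()
  at-view (ω₁ M) (pairR ∷ p) ()
  at-view (ω₁ M) (ω₁D ∷ p) eq = at-ω₁ (at-view M p eq)
  at-view (ω₁ M) (ω₂D ∷ p) ()
  at-view (ω₁ M) (μD ∷ p) ()
  at-view (ω₁ M) (cvarD ∷ p) ()
  at-view (ω₁ M) (termD ∷ p) ()
  at-view (ω₁ M) (caseL ∷ p) ()
  at-view (ω₁ M) (caseR ∷ p) ()
  at-view (ω₂ M) (lamD ∷ p) ()
  at-view (ω₂ M) (appFun ∷ p) ()
  at-view (ω₂ M) (appArg ∷ p) ()
  at-view (ω₂ M) (pairL ∷ p) ()
  at-view (ω₂ M) (pairR ∷ p) ()
  at-view (ω₂ M) (ω₁D ∷ p) ()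
  at-view (ω₂ M) (ω₂D ∷ p) eq = at-ω₂ (at-view M p eq)
  at-view (ω₂ M) (μD ∷ p) ()
  at-view (ω₂ M) (cvarD ∷ p) ()
  at-view (ω₂ M) (termD ∷ p) ()
  at-view (ω₂ M) (caseL ∷ p) ()
  at-view (ω₂ M) (caseR ∷ p) ()
  at-view (μ M) (lamD ∷ p) ()
  at-view (μ M) (appFun ∷ p) ()
  at-view (μ M) (appArg ∷ p) ()
  at-view (μ M) (pairL ∷ p) ()
  at-view (μ M) (pairR ∷ p) ()
  at-view (μ M) (ω₁D ∷ p) ()
  at-view (μ M) (ω₂D ∷ p) ()
  at-view (μ M) (μD ∷ p) eq = at-μ (at-view M p eq)
  at-view (μ M) (cvarD ∷ p) ()
  at-view (μ M) (termD ∷ p) ()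
  at-view (μ M) (caseL ∷ p) ()
  at-view (μ M) (caseR ∷ p) ()
  at-view (cvar a M) (lamD ∷ p) ()
  at-view (cvar a M) (appFun ∷ p) ()
  at-view (cvar a M) (appArg ∷ p) ()
  at-view (cvar a M) (pairL ∷ p) ()
  at-view (cvar a M) (pairR ∷ p) ()
  at-view (cvar a M) (ω₁D ∷ p) ()
  at-view (cvar a M) (ω₂D ∷ p) ()
  at-view (cvar a M) (μD ∷ p) ()
  at-view (cvar a M) (cvarD ∷ p) eq = at-cvar (at-view M p eq)
  at-view (cvar a M) (termD ∷ p) ()
  at-view (cvar a M) (caseL ∷ p) ()
  at-view (cvar a M) (caseR ∷ p) ()
  at-view (K ⋆) (d ∷ p) ()

  arg-view : ∀ e p → atE e p ≡ just v → At (app M e) (appArg ∷ p) v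
  arg-view e [] refl = at-arg
  arg-view (term N) (lamD ∷ p) ()
  arg-view (term N) (appFun ∷ p) ()
  arg-view (term N) (appArg ∷ p) ()
  arg-view (term N) (pairL ∷ p) ()
  arg-view (term N) (pairR ∷ p) ()
  arg-view (term N) (ω₁D ∷ p) ()
  arg-view (term N) (ω₂D ∷ p) ()
  arg-view (term N) (μD ∷ p) ()
  arg-view (term N) (cvarD ∷ p) ()
  arg-view (term N) (termD ∷ p) eq = at-term (at-view N p eq)
  arg-view (term N) (caseL ∷ p) ()
  arg-view (term N) (caseR ∷ p) ()
  arg-view (case N₁ N₂) (lamD ∷ p) ()
  arg-view (case N₁ N₂) (appFun ∷ p) ()
  arg-view (case N₁ N₂) (appArg ∷ p) ()
  arg-view (case N₁ N₂) (pairL ∷ p) ()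
  arg-view (case N₁ N₂) (pairR ∷ p) ()
  arg-view (case N₁ N₂) (ω₁D ∷ p) ()
  arg-view (case N₁ N₂) (ω₂D ∷ p) ()
  arg-view (case N₁ N₂) (μD ∷ p) ()
  arg-view (case N₁ N₂) (cvarD ∷ p) ()
  arg-view (case N₁ N₂) (termD ∷ p) ()
  arg-view (case N₁ N₂) (caseL ∷ p) eq = at-caseL (at-view N₁ p eq)
  arg-view (case N₁ N₂) (caseR ∷ p) eq = at-caseR (at-view N₂ p eq)
  arg-view π₁ (d ∷ p) ()
  arg-view π₂ (d ∷ p) ()
  arg-view (box ε) (d ∷ p) ()

SubtermAt : Tm true → Path → Tm true → Set
SubtermAt T ds C = ∀ p → at T (ds ++ p) ≡ at C p

MuFree : Path → Set
MuFree ds = ∀ r → μcount (ds ++ r) ≡ μcount r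

data ChildAt : Tm true → Path → Tm true → Set where
  lam-body   : ChildAt (lam M) (lamD ∷ []) M
  app-fun    : ChildAt (app M e) (appFun ∷ []) M
  term-arg   : ChildAt (app M (term N)) (appArg ∷ termD ∷ []) N
  case-left  : ChildAt (app M (case N₁ N₂)) (appArg ∷ caseL ∷ []) N₁
  case-right : ChildAt (app M (case N₁ N₂)) (appArg ∷ caseR ∷ []) N₂
  pair-left  : ChildAt (pair M N) (pairL ∷ []) M
  pair-right : ChildAt (pair M N) (pairR ∷ []) N
  ω₁-body    : ChildAt (ω₁ M) (ω₁D ∷ []) M
  ω₂-body    : ChildAt (ω₂ M) (ω₂D ∷ []) M
  cvar-body  : ChildAt (cvar a M) (cvarD ∷ []) M

ChildAt⇒SubtermAt : ∀ {ds C} → ChildAt T ds C → SubtermAt T ds C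
ChildAt⇒SubtermAt lam-body   _ = refl
ChildAt⇒SubtermAt app-fun    _ = refl
ChildAt⇒SubtermAt term-arg   _ = refl
ChildAt⇒SubtermAt case-left  _ = refl
ChildAt⇒SubtermAt case-right _ = refl
ChildAt⇒SubtermAt pair-left  _ = refl
ChildAt⇒SubtermAt pair-right _ = refl
ChildAt⇒SubtermAt ω₁-body    _ = refl
ChildAt⇒SubtermAt ω₂-body    _ = refl
ChildAt⇒SubtermAt cvar-body  _ = refl

ChildAt⇒MuFree : ∀ {ds C} → ChildAt T ds C → MuFree ds
ChildAt⇒MuFree lam-body   _ = refl
ChildAt⇒MuFree app-fun    _ = refl
ChildAt⇒MuFree term-arg   _ = refl
ChildAt⇒MuFree case-left  _ = refl
ChildAt⇒MuFree case-right _ = refl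
ChildAt⇒MuFree pair-left  _ = refl
ChildAt⇒MuFree pair-right _ = refl
ChildAt⇒MuFree ω₁-body    _ = refl
ChildAt⇒MuFree ω₂-body    _ = refl
ChildAt⇒MuFree cvar-body  _ = refl

data BoxOwner (T : Tm true) (ε : Eps) (p : Path) : Set where
  boxOf : ∀ {q U} → p ≡ q ++ appArg ∷ [] → at T q ≡ just (tmN (app U (box ε))) → Acceptable U →
          BoxOwner T ε p

-- In acceptable mode a star may also be owned from outside, through st(T).
Outer : Bool → Tm true → Path → Set
Outer false T p = ⊥
Outer true  T p = InSt T p

data StarOwner (Γ : Ctx) (X : Path → Set) (T : Tm true) (p : Path) : Set where
  byBox : ∀ {q U ε r} → at T q ≡ just (tmN (app U (box ε))) → Acceptable U → InSt U r →
          p ≡ q ++ appFun ∷ r → StarOwner Γ X T p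
  byVar : ∀ {r j S s} → at T r ≡ just (tmN (cvar (μcount r + j) S)) → Γ j ≡ true → InSt S s →
          p ≡ r ++ cvarD ∷ s → StarOwner Γ X T p
  outer : X p → StarOwner Γ X T p

VarArgsAcceptable : Ctx → Tm true → Set
VarArgsAcceptable Γ T =
  ∀ r j S → at T r ≡ just (tmN (cvar (μcount r + j) S)) → Γ j ≡ true → Acceptable S

-- Correct, relativised to a subterm T of mode b in Γ; at position r,
-- μcount r + j is the free classical variable j of T.
record Layout (Γ : Ctx) (b : Bool) (T : Tm true) : Set where
  field
    boxes   : ∀ q ε → at T q ≡ just (elN (box ε)) → BoxOwner T ε q
    stars   : ∀ p K → at T p ≡ just (tmN (K ⋆)) → StarOwner Γ (Outer b T) T p
    varArgs : VarArgsAcceptable Γ T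

cvar-at : ∀ {m n} → m ≡ n → At T r (tmN (cvar m S)) → At T r (tmN (cvar n S))
cvar-at refl o = o

cvar-≡ : ∀ {m n} {o : Maybe Node} → m ≡ n → o ≡ just (tmN (cvar m S)) → o ≡ just (tmN (cvar n S))
cvar-≡ refl eq = eq

mutual
  ⊢⇒acceptable : Γ ⊢[ true ] T → Acceptable T
  ⊢⇒acceptable ⊢⋆                   = acc⋆
  ⊢⇒acceptable (⊢μ {M = M} h)       = accμ λ p S eq →
    ⊢⇒varArg h (cvar-at (sym (+-identityʳ _)) (at-view M p eq)) refl
  ⊢⇒acceptable (⊢app _ (case⇒ h₁ h₂)) = acccase (⊢⇒acceptable h₁) (⊢⇒acceptable h₂)

  ⊢⇒varArg : ∀ {j} → Γ ⊢[ b ] T → At T r (tmN (cvar (μcount r + j) S)) → Γ j ≡ true → Acceptable S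
  ⊢⇒varArg {Γ = Γ} (⊢cvar h)   at-here      Γj = ⊢⇒acceptable (subst (Γ ⊢[_] _) Γj h)
  ⊢⇒varArg (⊢lam h)             (at-lam o)   Γj = ⊢⇒varArg h o Γj
  ⊢⇒varArg (⊢app h _)           (at-fun o)   Γj = ⊢⇒varArg h o Γj
  ⊢⇒varArg (⊢app _ (term⇒ h))   (at-term o)  Γj = ⊢⇒varArg h o Γj
  ⊢⇒varArg (⊢app _ (case⇒ h _)) (at-caseL o) Γj = ⊢⇒varArg h o Γj
  ⊢⇒varArg (⊢app _ (case⇒ _ h)) (at-caseR o) Γj = ⊢⇒varArg h o Γj
  ⊢⇒varArg (⊢pair h _)          (at-pairL o) Γj = ⊢⇒varArg h o Γj
  ⊢⇒varArg (⊢pair _ h)          (at-pairR o) Γj = ⊢⇒varArg h o Γj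
  ⊢⇒varArg (⊢ω₁ h)              (at-ω₁ o)    Γj = ⊢⇒varArg h o Γj
  ⊢⇒varArg (⊢ω₂ h)              (at-ω₂ o)    Γj = ⊢⇒varArg h o Γj
  ⊢⇒varArg (⊢μ h)               (at-μ o)     Γj = ⊢⇒varArg h (cvar-at (sym (+-suc _ _)) o) Γj
  ⊢⇒varArg (⊢cvar h)            (at-cvar o)  Γj = ⊢⇒varArg h o Γj

boxOwner-↑ : ∀ {ds C ε} → ChildAt T ds C → BoxOwner C ε q → BoxOwner T ε (ds ++ q)
boxOwner-↑ {ds = ds} c (boxOf {q = q} refl atU acc) =
  boxOf (sym (++-assoc ds q _)) (trans (ChildAt⇒SubtermAt c q) atU) acc

⊢⇒boxOwner : ∀ {ε} → Γ ⊢[ b ] T → At T q (elN (box ε)) → BoxOwner T ε q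
⊢⇒boxOwner (⊢app h box⇒)        at-arg       = boxOf {q = []} refl refl (⊢⇒acceptable h)
⊢⇒boxOwner (⊢lam h)             (at-lam o)   = boxOwner-↑ lam-body (⊢⇒boxOwner h o)
⊢⇒boxOwner (⊢app h _)           (at-fun o)   = boxOwner-↑ app-fun (⊢⇒boxOwner h o)
⊢⇒boxOwner (⊢app _ (term⇒ h))   (at-term o)  = boxOwner-↑ term-arg (⊢⇒boxOwner h o)
⊢⇒boxOwner (⊢app _ (case⇒ h _)) (at-caseL o) = boxOwner-↑ case-left (⊢⇒boxOwner h o)
⊢⇒boxOwner (⊢app _ (case⇒ _ h)) (at-caseR o) = boxOwner-↑ case-right (⊢⇒boxOwner h o)
⊢⇒boxOwner (⊢pair h _)          (at-pairL o) = boxOwner-↑ pair-left (⊢⇒boxOwner h o)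
⊢⇒boxOwner (⊢pair _ h)          (at-pairR o) = boxOwner-↑ pair-right (⊢⇒boxOwner h o)
⊢⇒boxOwner (⊢ω₁ h)              (at-ω₁ o)    = boxOwner-↑ ω₁-body (⊢⇒boxOwner h o)
⊢⇒boxOwner (⊢ω₂ h)              (at-ω₂ o)    = boxOwner-↑ ω₂-body (⊢⇒boxOwner h o)
⊢⇒boxOwner (⊢cvar h)            (at-cvar o)  = boxOwner-↑ cvar-body (⊢⇒boxOwner h o)
⊢⇒boxOwner (⊢μ h)               (at-μ o)     with ⊢⇒boxOwner h o
... | boxOf {q = q} refl atU acc = boxOf {q = μD ∷ q} refl atU acc

starOwner-↑ : ∀ {ds C X Y} → ChildAt T ds C →
              (∀ {p} → X p → StarOwner Γ Y T (ds ++ p)) → StarOwner Γ X C p → StarOwner Γ Y T (ds ++ p)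
starOwner-↑ {ds = ds} c f (byBox {q = q} atq acc ist refl) =
  byBox (trans (ChildAt⇒SubtermAt c q) atq) acc ist (sym (++-assoc ds q _))
starOwner-↑ {ds = ds} c f (byVar {r = r} atr Γj ist refl) =
  byVar (trans (ChildAt⇒SubtermAt c r) (cvar-≡ (cong (_+ _) (sym (ChildAt⇒MuFree c r))) atr)) Γj ist
        (sym (++-assoc ds r _))
starOwner-↑ c f (outer x) = f x

starOwner-↑μ : StarOwner (Γ ▸ b) (Outer false M) M p → StarOwner Γ (Outer b (μ M)) (μ M) (μD ∷ p)
starOwner-↑μ (byBox {q = q} atq acc ist refl)          = byBox {q = μD ∷ q} atq acc ist refl
starOwner-↑μ (byVar {j = zero} atr refl ist refl)      = outer (stμ (cvar-≡ (+-identityʳ _) atr) ist)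
starOwner-↑μ (byVar {r = r} {j = suc j} atr Γj ist refl) =
  byVar {r = μD ∷ r} {j = j} (cvar-≡ (+-suc (μcount r) j) atr) Γj ist refl

⊢⇒star : ∀ {K} → Γ ⊢[ b ] T → At T p (tmN (K ⋆)) → StarOwner Γ (Outer b T) T p
⊢⇒star ⊢⋆                   at-here      = outer st⋆
⊢⇒star (⊢lam h)             (at-lam o)   = starOwner-↑ lam-body (λ ()) (⊢⇒star h o)
⊢⇒star (⊢app h hₑ)          (at-fun o)   = starOwner-↑ app-fun (fun-outer h hₑ) (⊢⇒star h o)
  where
    fun-outer : Γ ⊢[ b ] M → Γ ⊢ e ∶ b ⇒ b′ → Outer b M p →
                StarOwner Γ (Outer b′ (app M e)) (app M e) (appFun ∷ p)
    fun-outer {b = true} h box⇒ ist = byBox {q = []} refl (⊢⇒acceptable h) ist refl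
⊢⇒star (⊢app _ (term⇒ h))   (at-term o)  = starOwner-↑ term-arg (λ ()) (⊢⇒star h o)
⊢⇒star (⊢app _ (case⇒ h _)) (at-caseL o) = starOwner-↑ case-left (outer ∘ caseL-outer _) (⊢⇒star h o)
  where
    caseL-outer : ∀ b → Outer b N₁ p → Outer b (app M (case N₁ N₂)) (appArg ∷ caseL ∷ p)
    caseL-outer true ist = stcaseˡ ist
⊢⇒star (⊢app _ (case⇒ _ h)) (at-caseR o) = starOwner-↑ case-right (outer ∘ caseR-outer _) (⊢⇒star h o)
  where
    caseR-outer : ∀ b → Outer b N₂ p → Outer b (app M (case N₁ N₂)) (appArg ∷ caseR ∷ p)
    caseR-outer true ist = stcaseʳ ist
⊢⇒star (⊢pair h _)          (at-pairL o) = starOwner-↑ pair-left (λ ()) (⊢⇒star h o)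
⊢⇒star (⊢pair _ h)          (at-pairR o) = starOwner-↑ pair-right (λ ()) (⊢⇒star h o)
⊢⇒star (⊢ω₁ h)              (at-ω₁ o)    = starOwner-↑ ω₁-body (λ ()) (⊢⇒star h o)
⊢⇒star (⊢ω₂ h)              (at-ω₂ o)    = starOwner-↑ ω₂-body (λ ()) (⊢⇒star h o)
⊢⇒star (⊢μ h)               (at-μ o)     = starOwner-↑μ (⊢⇒star h o)
⊢⇒star {Γ = Γ} (⊢cvar {a = a} h) (at-cvar o) =
  starOwner-↑ cvar-body (cvar-outer (Γ a) refl) (⊢⇒star h o)
  where
    cvar-outer : ∀ c → Γ a ≡ c → Outer c S p →
                 StarOwner Γ (Outer false (cvar a S)) (cvar a S) (cvarD ∷ p)
    cvar-outer true Γa ist = byVar {r = []} refl Γa ist refl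

⊢⇒layout : Γ ⊢[ b ] T → Layout Γ b T
⊢⇒layout {T = T} h = record
  { boxes   = λ q ε eq → ⊢⇒boxOwner h (at-view T q eq)
  ; stars   = λ p K eq → ⊢⇒star h (at-view T p eq)
  ; varArgs = λ r j S eq → ⊢⇒varArg h (at-view T r eq)
  }

[]≢++∷ : ∀ (q : Path) {d t} → [] ≢ q ++ d ∷ t
[]≢++∷ []      ()
[]≢++∷ (_ ∷ _) ()

++-split : ∀ ds {p} q {d t} → ds ++ p ≡ q ++ d ∷ t →
           (Σ[ q′ ∈ Path ] (q ≡ ds ++ q′ × p ≡ q′ ++ d ∷ t)) ⊎
           (Σ[ s ∈ Path ] (ds ≡ q ++ d ∷ s × t ≡ s ++ p))
++-split []       q       eq   = inj₁ (q , refl , eq)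
++-split (_ ∷ ds) []      refl = inj₂ (ds , refl , refl)
++-split (_ ∷ ds) (_ ∷ q) eq with ∷-injective eq
... | refl , eq′ with ++-split ds q eq′
...   | inj₁ (q′ , refl , eq″) = inj₁ (q′ , refl , eq″)
...   | inj₂ (s , refl , eq″)  = inj₂ (s , refl , eq″)

boxes-↓ : ∀ {C} ds → SubtermAt T ds C →
          (∀ q ε → at T q ≡ just (elN (box ε)) → BoxOwner T ε q) →
          ∀ q ε → at C q ≡ just (elN (box ε)) → BoxOwner C ε q
boxes-↓ ds sub boxes (d ∷ q) ε eq with boxes (ds ++ d ∷ q) ε (trans (sub (d ∷ q)) eq)
... | boxOf {q = q′} eq′ atU acc with ++-split ds {d ∷ q} q′ eq′
...   | inj₁ (q″ , refl , eq″) = boxOf eq″ (trans (sym (sub q″)) atU) acc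
...   | inj₂ (s , _ , []≡)     = ⊥-elim ([]≢++∷ s []≡)

-- owners, lying outside the subterm at ds, of a star inside it
data Above (Γ : Ctx) (X : Path → Set) (T : Tm true) (ds p : Path) : Set where
  outer : X (ds ++ p) → Above Γ X T ds p
  byBox : ∀ {q U ε s} → ds ≡ q ++ appFun ∷ s → at T q ≡ just (tmN (app U (box ε))) →
          Acceptable U → InSt U (s ++ p) → Above Γ X T ds p
  byVar : ∀ {r j S s} → ds ≡ r ++ cvarD ∷ s → at T r ≡ just (tmN (cvar (μcount r + j) S)) →
          Γ j ≡ true → InSt S (s ++ p) → Above Γ X T ds p

starOwner-↓ : ∀ {ds C X} → ChildAt T ds C →
              StarOwner Γ X T (ds ++ p) → StarOwner Γ (Above Γ X T ds) C p
starOwner-↓ {ds = ds} c (byBox {q = q} atq acc ist eq) with ++-split ds q eq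
... | inj₁ (q′ , refl , eq′) = byBox (trans (sym (ChildAt⇒SubtermAt c q′)) atq) acc ist eq′
... | inj₂ (s , eq′ , refl)  = outer (byBox eq′ atq acc ist)
starOwner-↓ {ds = ds} c (byVar {r = r} atr Γj ist eq) with ++-split ds r eq
... | inj₁ (r′ , refl , eq′) =
  byVar (trans (sym (ChildAt⇒SubtermAt c r′)) (cvar-≡ (cong (_+ _) (ChildAt⇒MuFree c r′)) atr))
        Γj ist eq′
... | inj₂ (s , eq′ , refl)  = outer (byVar eq′ atr Γj ist)
starOwner-↓ c (outer x) = outer (outer x)

mapOuter : ∀ {X Y} → (∀ {p} → X p → Y p) → StarOwner Γ X T p → StarOwner Γ Y T p
mapOuter f (byBox atq acc ist eq) = byBox atq acc ist eq
mapOuter f (byVar atr Γj ist eq)  = byVar atr Γj ist eq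
mapOuter f (outer x)              = outer (f x)

layout-↓ : ∀ {ds C} → ChildAt T ds C → (∀ {p} → Above Γ (Outer b T) T ds p → Outer b′ C p) →
           Layout Γ b T → Layout Γ b′ C
layout-↓ {ds = ds} c above L = record
  { boxes   = boxes-↓ ds (ChildAt⇒SubtermAt c) boxes
  ; stars   = λ p K eq →
      mapOuter above (starOwner-↓ c (stars (ds ++ p) K (trans (ChildAt⇒SubtermAt c p) eq)))
  ; varArgs = λ r j S eq →
      varArgs (ds ++ r) j S
        (trans (ChildAt⇒SubtermAt c r) (cvar-≡ (cong (_+ j) (sym (ChildAt⇒MuFree c r))) eq))
  }
  where open Layout L

AcceptableIf : Bool → Tm true → Set
AcceptableIf false T = ⊤
AcceptableIf true  T = Acceptable T

starOwner-↓μ : StarOwner Γ (Outer b (μ M)) (μ M) (μD ∷ p) → StarOwner (Γ ▸ b) (Outer false M) M p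
starOwner-↓μ (byBox {q = []} _ _ _ ())
starOwner-↓μ (byBox {q = _ ∷ q} atq acc ist refl)        = byBox {q = q} atq acc ist refl
starOwner-↓μ (byVar {r = []} _ _ _ ())
starOwner-↓μ (byVar {r = _ ∷ r} {j} atr Γj ist refl)     =
  byVar {j = suc j} (cvar-≡ (sym (+-suc (μcount r) j)) atr) Γj ist refl
starOwner-↓μ {b = true} (outer (stμ atr ist))           =
  byVar {j = 0} (cvar-≡ (sym (+-identityʳ _)) atr) refl ist refl

varArgs-↓μ : AcceptableIf b (μ M) → VarArgsAcceptable Γ (μ M) → VarArgsAcceptable (Γ ▸ b) M
varArgs-↓μ {b = true} (accμ f) varArgs r zero    S eq refl = f r S (cvar-≡ (+-identityʳ _) eq)
varArgs-↓μ acc varArgs r (suc j) S eq Γj = varArgs (μD ∷ r) j S (cvar-≡ (+-suc (μcount r) j) eq) Γj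

layout-↓μ : AcceptableIf b (μ M) → Layout Γ b (μ M) → Layout (Γ ▸ b) false M
layout-↓μ acc L = record
  { boxes   = boxes-↓ (μD ∷ []) (λ _ → refl) boxes
  ; stars   = λ p K eq → starOwner-↓μ (stars (μD ∷ p) K eq)
  ; varArgs = varArgs-↓μ acc varArgs
  }
  where open Layout L

data AboveChild (Γ : Ctx) (X : Path → Set) : Tm true → Dir → Path → Set where
  outer : X (d ∷ p) → AboveChild Γ X T d p
  byBox : ∀ {ε} → Acceptable U → InSt U p → AboveChild Γ X (app U (box ε)) appFun p
  byVar : ∀ {j} → Γ j ≡ true → InSt S p → AboveChild Γ X (cvar j S) cvarD p

above-child : ∀ {X} → Above Γ X T (d ∷ []) p → AboveChild Γ X T d p
above-child (outer x)                          = outer x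
above-child (byBox {q = []} refl refl acc ist) = byBox acc ist
above-child (byBox {q = _ ∷ q} eq _ _ _)       = ⊥-elim ([]≢++∷ q (∷-injectiveʳ eq))
above-child (byVar {r = []} refl refl Γj ist)  = byVar Γj ist
above-child (byVar {r = _ ∷ r} eq _ _ _)       = ⊥-elim ([]≢++∷ r (∷-injectiveʳ eq))

above-arg : ∀ {X} → Above Γ X (app M e) (appArg ∷ d ∷ []) p → X (appArg ∷ d ∷ p)
above-arg (outer x)                            = x
above-arg (byBox {q = []} () _ _ _)
above-arg (byBox {q = _ ∷ []} refl () _ _)
above-arg (byBox {q = _ ∷ _ ∷ q} eq _ _ _)     = ⊥-elim ([]≢++∷ q (∷-injectiveʳ (∷-injectiveʳ eq)))
above-arg (byVar {r = []} () _ _ _)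
above-arg (byVar {r = _ ∷ []} refl () _ _)
above-arg (byVar {r = _ ∷ _ ∷ r} eq _ _ _)     = ⊥-elim ([]≢++∷ r (∷-injectiveʳ (∷-injectiveʳ eq)))

boxed-acceptable : ∀ {ε} → Layout Γ b (app M (box ε)) → Acceptable M
boxed-acceptable {ε = ε} L with Layout.boxes L (appArg ∷ []) ε refl
... | boxOf {q = []} refl refl acc = acc
... | boxOf {q = _ ∷ q} eq _ _      = ⊥-elim ([]≢++∷ q (∷-injectiveʳ eq))

unowned-star : ∀ {K} → ¬ Layout Γ false (K ⋆)
unowned-star {K = K} L with Layout.stars L [] K refl
... | byBox {q = q} _ _ _ eq = []≢++∷ q eq
... | byVar {r = r} _ _ _ eq = []≢++∷ r eq

mutual
  layout⇒⊢ : ∀ b T → AcceptableIf b T → Layout Γ b T → Γ ⊢[ b ] T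
  layout⇒⊢ false (var x)    _ L = ⊢var
  layout⇒⊢ false (lam M)    _ L = ⊢lam (child lam-body (λ { (outer ()) }) tt L)
  layout⇒⊢ false (pair M N) _ L =
    ⊢pair (child pair-left (λ { (outer ()) }) tt L) (child pair-right (λ { (outer ()) }) tt L)
  layout⇒⊢ false (ω₁ M)     _ L = ⊢ω₁ (child ω₁-body (λ { (outer ()) }) tt L)
  layout⇒⊢ false (ω₂ M)     _ L = ⊢ω₂ (child ω₂-body (λ { (outer ()) }) tt L)
  layout⇒⊢ b     (μ M)      acc L = ⊢μ (layout⇒⊢ false M tt (layout-↓μ acc L))
  layout⇒⊢ {Γ = Γ} false (cvar a S) _ L =
    ⊢cvar (child cvar-body var-owner (cvar-acceptable (Γ a) refl) L)
    where
      var-owner : ∀ {p} → AboveChild Γ (Outer false (cvar a S)) (cvar a S) cvarD p → Outer (Γ a) S p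
      var-owner {p} (byVar Γa ist) = subst (λ c → Outer c S p) (sym Γa) ist

      cvar-acceptable : ∀ c → Γ a ≡ c → AcceptableIf c S
      cvar-acceptable false _  = tt
      cvar-acceptable true  Γa = Layout.varArgs L [] a S refl Γa
  layout⇒⊢ false (K ⋆)      _ L = ⊥-elim (unowned-star L)
  layout⇒⊢ true  (K ⋆)      _ L = ⊢⋆
  layout⇒⊢ false (app M (term N)) _ L =
    ⊢app (child app-fun (λ { (outer ()) }) tt L) (term⇒ (arg-child term-arg (λ ()) tt L))
  layout⇒⊢ false (app M π₁) _ L = ⊢app (child app-fun (λ { (outer ()) }) tt L) π₁⇒
  layout⇒⊢ false (app M π₂) _ L = ⊢app (child app-fun (λ { (outer ()) }) tt L) π₂⇒
  layout⇒⊢ false (app M (case N₁ N₂)) _ L =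
    ⊢app (child app-fun (λ { (outer ()) }) tt L)
         (case⇒ (arg-child case-left (λ ()) tt L) (arg-child case-right (λ ()) tt L))
  layout⇒⊢ true (app M (case N₁ N₂)) (acccase acc₁ acc₂) L =
    ⊢app (child app-fun (λ { (outer ()) }) tt L)
         (case⇒ (arg-child case-left (λ { (stcaseˡ ist) → ist }) acc₁ L)
                (arg-child case-right (λ { (stcaseʳ ist) → ist }) acc₂ L))
  layout⇒⊢ false (app M (box ε)) _ L =
    ⊢app (child app-fun (λ { (byBox _ ist) → ist }) (boxed-acceptable L) L) box⇒

  child : ∀ {b b′ d C} → ChildAt T (d ∷ []) C →
          (∀ {p} → AboveChild Γ (Outer b T) T d p → Outer b′ C p) → AcceptableIf b′ C →
          Layout Γ b T → Γ ⊢[ b′ ] C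
  child {b′ = b′} {C = C} c above acc L = layout⇒⊢ b′ C acc (layout-↓ c (above ∘ above-child) L)

  arg-child : ∀ {b b′ d C} → ChildAt (app M e) (appArg ∷ d ∷ []) C →
              (∀ {p} → Outer b (app M e) (appArg ∷ d ∷ p) → Outer b′ C p) → AcceptableIf b′ C →
              Layout Γ b (app M e) → Γ ⊢[ b′ ] C
  arg-child {b′ = b′} {C = C} c above acc L = layout⇒⊢ b′ C acc (layout-↓ c (above ∘ above-arg) L)

∅ : Ctx
∅ _ = false

correct⇒layout : Correct M → Layout ∅ false M
correct⇒layout c = record
  { boxes   = λ q ε eq → case Correct.boxes c q ε eq of λ
      { (_ , _ , eq′ , atU , acc) → boxOf eq′ atU acc }
  ; stars   = λ p K eq → case Correct.stars c p K eq of λ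
      { (_ , _ , _ , _ , atq , acc , ist , eq′) → byBox atq acc ist eq′ }
  ; varArgs = λ _ _ _ _ ()
  }

layout⇒correct : Layout ∅ false M → Correct M
layout⇒correct L = record
  { boxes = λ q ε eq → case Layout.boxes L q ε eq of λ
      { (boxOf eq′ atU acc) → _ , _ , eq′ , atU , acc }
  ; stars = λ p K eq → case Layout.stars L p K eq of λ
      { (byBox atq acc ist eq′) → _ , _ , _ , _ , atq , acc , ist , eq′
      ; (byVar _ () _ _)
      ; (outer ()) }
  }

lemma5p5 : (M M′ : Tm true) → Correct M → M ▷ M′ → Correct M′
lemma5p5 M M′ c r =
  layout⇒correct (⊢⇒layout (⊢-red (λ _ → refl) r (layout⇒⊢ false M tt (correct⇒layout c))))
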